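{- Let $X$ be an orthomodular lattice and $a\in X$. (1) The downset ${\downarrow}a=\{u\in X: u\le a\}$ is an orthomodular lattice, with order, meets and joins as in $X$, and with orthocomplement $u^{\perp_a}=a\wedge u^\perp$. (2) The pair $a=(a_*,a^*)$ with $a_*(u)=u^\perp$ for $u\in{\downarrow}a$ and $a^*(x)=a\wedge x^\perp$ for $x\in X$ is a morphism ${\downarrow}a\to X$ in $\mathbf{OMLatGal}$ which is a dagger mono, i.e. $a^\dagger\circ a=\mathrm{id}_{{\downarrow}a}$.
   Context: An orthomodular lattice is a bounded lattice with orthocomplement $x\mapsto x^\perp$ ($x^{\perp\perp}=x$, order-reversing, $x\wedge x^\perp=0$) with $x\le y\Rightarrow y=x\vee(x^\perp\wedge y)$. $\mathbf{OMLatGal}$: objects orthomodular lattices; morphisms $f\colon X\to Y$ pairs $(f_*,f^*)$ of order-reversing maps $f_*\colon X\to Y$, $f^*\colon Y\to X$ with $x\le f^*(y)\iff y\le f_*(x)$; identity on $X$ is $((-)^\perp,(-)^\perp)$; composition $(g\circ f)_*=g_*\circ(-)^\perp\circ f_*$, $(g\circ f)^*=f^*\circ(-)^\perp\circ g^*$; dagger $(f_*,f^*)^\dagger=(f^*,f_*)$. -}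

module Defs where

open import Level using (Level; _⊔_)
open import Data.Product using (Σ; _,_; proj₁; proj₂; _×_)
open import Relation.Binary.Core using (Rel)
open import Relation.Binary.Lattice.Structures using (IsBoundedLattice)
open import Relation.Binary.Structures using (IsPartialOrder)
open import Algebra.Core using (Op₁; Op₂)

record IsOrthomodularLattice {c ℓ₁ ℓ₂ : Level} {A : Set c}
    (_≈_ : Rel A ℓ₁) (_≤_ : Rel A ℓ₂)
    (_∨_ : Op₂ A) (_∧_ : Op₂ A) (⊤ : A) (⊥ : A) (_ᗮ : Op₁ A)
    : Set (c ⊔ ℓ₁ ⊔ ℓ₂) where
  field
    isBoundedLattice : IsBoundedLattice _≈_ _≤_ _∨_ _∧_ ⊤ ⊥
    ᗮ-involutive     : ∀ x → ((x ᗮ) ᗮ) ≈ x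
    ᗮ-antitone       : ∀ {x y} → x ≤ y → (y ᗮ) ≤ (x ᗮ)
    ᗮ-meet           : ∀ x → (x ∧ (x ᗮ)) ≈ ⊥
    orthomodular     : ∀ {x y} → x ≤ y → y ≈ (x ∨ ((x ᗮ) ∧ y))

record OrthomodularLattice (c ℓ₁ ℓ₂ : Level) : Set (Level.suc (c ⊔ ℓ₁ ⊔ ℓ₂)) where
  infix 4 _≈_ _≤_
  infixr 6 _∨_
  infixr 7 _∧_
  field
    Carrier : Set c
    _≈_     : Rel Carrier ℓ₁
    _≤_     : Rel Carrier ℓ₂
    _∨_     : Op₂ Carrier
    _∧_     : Op₂ Carrier
    ⊤       : Carrier
    ⊥       : Carrier
    _ᗮ      : Op₁ Carrier
    isOrthomodularLattice : IsOrthomodularLattice _≈_ _≤_ _∨_ _∧_ ⊤ ⊥ _ᗮ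
  open IsOrthomodularLattice isOrthomodularLattice public
  open IsBoundedLattice isBoundedLattice public

module _ {c ℓ₁ ℓ₂ d m₁ m₂ : Level}
         (X : OrthomodularLattice c ℓ₁ ℓ₂) (Y : OrthomodularLattice d m₁ m₂) where
  private
    module X = OrthomodularLattice X
    module Y = OrthomodularLattice Y

  GalPair : Set (c ⊔ d)
  GalPair = (X.Carrier → Y.Carrier) × (Y.Carrier → X.Carrier)

  IsOMLatGalMorphism : GalPair → Set (c ⊔ d ⊔ ℓ₂ ⊔ m₂)
  IsOMLatGalMorphism (f₊ , f⁺) =
    (∀ {x x'} → x X.≤ x' → f₊ x' Y.≤ f₊ x) ×
    (∀ {y y'} → y Y.≤ y' → f⁺ y' X.≤ f⁺ y) ×
    (∀ x y → (x X.≤ f⁺ y → y Y.≤ f₊ x) × (y Y.≤ f₊ x → x X.≤ f⁺ y))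

  _≈Gal_ : GalPair → GalPair → Set (c ⊔ d ⊔ ℓ₁ ⊔ m₁)
  (f₊ , f⁺) ≈Gal (g₊ , g⁺) = (∀ x → f₊ x Y.≈ g₊ x) × (∀ y → f⁺ y X.≈ g⁺ y)

  dagger : GalPair → (Y.Carrier → X.Carrier) × (X.Carrier → Y.Carrier)
  dagger (f₊ , f⁺) = (f⁺ , f₊)

idGal : {c ℓ₁ ℓ₂ : Level} (X : OrthomodularLattice c ℓ₁ ℓ₂) → GalPair X X
idGal X = (OrthomodularLattice._ᗮ X , OrthomodularLattice._ᗮ X)

compGal : {c ℓ₁ ℓ₂ d m₁ m₂ e n₁ n₂ : Level}
  (X : OrthomodularLattice c ℓ₁ ℓ₂) (Y : OrthomodularLattice d m₁ m₂)
  (Z : OrthomodularLattice e n₁ n₂) →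
  GalPair Y Z → GalPair X Y → GalPair X Z
compGal X Y Z (g₊ , g⁺) (f₊ , f⁺) =
  ( (λ x → g₊ (OrthomodularLattice._ᗮ Y (f₊ x)))
  , (λ z → f⁺ (OrthomodularLattice._ᗮ Y (g⁺ z))) )

module Downset {c ℓ₁ ℓ₂ : Level} (X : OrthomodularLattice c ℓ₁ ℓ₂)
               (a : OrthomodularLattice.Carrier X) where
  open OrthomodularLattice X

  D : Set (c ⊔ ℓ₂)
  D = Σ Carrier (λ u → u ≤ a)

  _≈D_ : Rel D ℓ₁
  u ≈D v = proj₁ u ≈ proj₁ v

  _≤D_ : Rel D ℓ₂
  u ≤D v = proj₁ u ≤ proj₁ v

  private
    ≤-trans' : ∀ {x y z} → x ≤ y → y ≤ z → x ≤ z
    ≤-trans' = IsPartialOrder.trans isPartialOrder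

  _∧D_ : Op₂ D
  (u , p) ∧D (v , q) = (u ∧ v) , ≤-trans' (proj₁ (infimum u v)) p

  _∨D_ : Op₂ D
  (u , p) ∨D (v , q) = (u ∨ v) , proj₂ (proj₂ (supremum u v)) a p q

  ⊤D : D
  ⊤D = a , IsPartialOrder.refl isPartialOrder

  ⊥D : D
  ⊥D = ⊥ , minimum a

  a∧ᗮ : Carrier → D
  a∧ᗮ x = (a ∧ (x ᗮ)) , proj₁ (infimum a (x ᗮ))

  _ᗮD : Op₁ D
  u ᗮD = a∧ᗮ (proj₁ u)

  ↓ : IsOrthomodularLattice _≈D_ _≤D_ _∨D_ _∧D_ ⊤D ⊥D _ᗮD →
      OrthomodularLattice (c ⊔ ℓ₂) ℓ₁ ℓ₂
  ↓ isOML = record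
    { Carrier = D ; _≈_ = _≈D_ ; _≤_ = _≤D_ ; _∨_ = _∨D_ ; _∧_ = _∧D_
    ; ⊤ = ⊤D ; ⊥ = ⊥D ; _ᗮ = _ᗮD ; isOrthomodularLattice = isOML }

  aMor : (isOML : IsOrthomodularLattice _≈D_ _≤D_ _∨D_ _∧D_ ⊤D ⊥D _ᗮD) →
         GalPair (↓ isOML) X
  aMor isOML = ((λ u → proj₁ u ᗮ) , a∧ᗮ)

module Submission where

-- Everything reduces to properties of the relative complement x ↦ a ∧ xᗮ,
-- proved in X (module OrthomodularFacts):
--   * it is antitone, and on ↓a it is Galois-adjoint to (-)ᗮ;
--   * it is involutive on ↓a — the one place orthomodularity of X is used:
--     for u ≤ a we have uᗮ = aᗮ ∨ (a ∧ uᗮ);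
--   * it meets u in ⊥, and meeting with it below a is meeting with uᗮ.

open import Defs
open import Level using (Level; _⊔_)
open import Data.Product using (Σ; _×_; _,_; proj₁; proj₂)
open import Relation.Binary.Lattice.Bundles using (Lattice)
open import Relation.Binary.Lattice.Structures using (IsBoundedLattice)
import Relation.Binary.Construct.On as On
import Relation.Binary.Lattice.Properties.MeetSemilattice as MeetProperties
import Relation.Binary.Lattice.Properties.JoinSemilattice as JoinProperties

module OrthomodularFacts {c ℓ₁ ℓ₂ : Level} (X : OrthomodularLattice c ℓ₁ ℓ₂) where
  open OrthomodularLattice X

  lattice : Lattice c ℓ₁ ℓ₂
  lattice = record { isLattice = isLattice }

  open Lattice lattice using (meetSemilattice; joinSemilattice)
  open MeetProperties meetSemilattice using (∧-monotonic)
  open JoinProperties joinSemilattice using (∨-monotonic; ∨-cong)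

  x≤xᗮᗮ : ∀ {x} → x ≤ (x ᗮ) ᗮ
  x≤xᗮᗮ {x} = reflexive (Eq.sym (ᗮ-involutive x))

  xᗮᗮ≤x : ∀ {x} → (x ᗮ) ᗮ ≤ x
  xᗮᗮ≤x {x} = reflexive (ᗮ-involutive x)

  ᗮ-swap : ∀ {x y} → x ≤ y ᗮ → y ≤ x ᗮ
  ᗮ-swap x≤yᗮ = trans x≤xᗮᗮ (ᗮ-antitone x≤yᗮ)

  ᗮ-reflect : ∀ {x y} → y ᗮ ≤ x ᗮ → x ≤ y
  ᗮ-reflect yᗮ≤xᗮ = trans x≤xᗮᗮ (trans (ᗮ-antitone yᗮ≤xᗮ) xᗮᗮ≤x)

  module RelativeComplement (a : Carrier) where

    relᗮ-antitone : ∀ {x y} → x ≤ y → a ∧ y ᗮ ≤ a ∧ x ᗮ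
    relᗮ-antitone x≤y = ∧-monotonic refl (ᗮ-antitone x≤y)

    relᗮ-galois : ∀ {u} y → u ≤ a →
                  (u ≤ a ∧ y ᗮ → y ≤ u ᗮ) × (y ≤ u ᗮ → u ≤ a ∧ y ᗮ)
    relᗮ-galois y u≤a =
        (λ u≤a∧yᗮ → ᗮ-swap (trans u≤a∧yᗮ (x∧y≤y _ _)))
      , (λ y≤uᗮ → ∧-greatest u≤a (ᗮ-swap y≤uᗮ))

    ᗮ-split : ∀ {u} → u ≤ a → u ᗮ ≤ a ᗮ ∨ (a ∧ u ᗮ)
    ᗮ-split u≤a =
      trans (reflexive (orthomodular (ᗮ-antitone u≤a)))
            (∨-monotonic refl (∧-monotonic xᗮᗮ≤x refl))

    relᗮ-involutive : ∀ {u} → u ≤ a → a ∧ (a ∧ u ᗮ) ᗮ ≈ u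
    relᗮ-involutive {u} u≤a =
      antisym (ᗮ-reflect uᗮ≤wᗮ) (∧-greatest u≤a (ᗮ-swap (x∧y≤y _ _)))
      where
      w≤a : a ∧ (a ∧ u ᗮ) ᗮ ≤ a
      w≤a = x∧y≤x _ _
      uᗮ≤wᗮ : u ᗮ ≤ (a ∧ (a ∧ u ᗮ) ᗮ) ᗮ
      uᗮ≤wᗮ = trans (ᗮ-split u≤a)
                (∨-least (ᗮ-swap (trans w≤a x≤xᗮᗮ)) (ᗮ-swap (x∧y≤y _ _)))

    relᗮ-meet : ∀ u → u ∧ (a ∧ u ᗮ) ≈ ⊥
    relᗮ-meet u =
      antisym (trans (∧-monotonic refl (x∧y≤y _ _)) (reflexive (ᗮ-meet u)))
              (minimum _)

    ∧-below : ∀ {v} x → v ≤ a → (a ∧ x) ∧ v ≈ x ∧ v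
    ∧-below x v≤a =
      antisym (∧-monotonic (x∧y≤y _ _) refl)
              (∧-greatest (∧-greatest (trans (x∧y≤y _ _) v≤a) (x∧y≤x _ _)) (x∧y≤y _ _))

    relᗮ-orthomodular : ∀ {u v} → u ≤ v → v ≤ a → v ≈ u ∨ ((a ∧ u ᗮ) ∧ v)
    relᗮ-orthomodular {u} u≤v v≤a =
      Eq.trans (orthomodular u≤v) (∨-cong Eq.refl (Eq.sym (∧-below (u ᗮ) v≤a)))

    relᗮ-ᗮᗮ : ∀ x → a ∧ ((x ᗮ) ᗮ) ᗮ ≈ a ∧ x ᗮ
    relᗮ-ᗮᗮ x = antisym (∧-monotonic refl xᗮᗮ≤x) (∧-monotonic refl x≤xᗮᗮ)

module DownsetProof {c ℓ₁ ℓ₂ : Level} (X : OrthomodularLattice c ℓ₁ ℓ₂)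
                    (a : OrthomodularLattice.Carrier X) where
  open OrthomodularLattice X
  open OrthomodularFacts X
  open RelativeComplement a
  open Downset X a

  isBoundedLattice-D : IsBoundedLattice _≈D_ _≤D_ _∨D_ _∧D_ ⊤D ⊥D
  isBoundedLattice-D = record
    { isLattice = record
      { isPartialOrder = On.isPartialOrder proj₁ isPartialOrder
      ; supremum = λ u v → let (u≤ , v≤ , least) = supremum (proj₁ u) (proj₁ v)
                           in u≤ , v≤ , λ w → least (proj₁ w)
      ; infimum = λ u v → let (≤u , ≤v , greatest) = infimum (proj₁ u) (proj₁ v)
                          in ≤u , ≤v , λ w → greatest (proj₁ w)
      }
    ; maximum = proj₂
    ; minimum = λ u → minimum (proj₁ u)
    }

  isOrthomodularLattice-D : IsOrthomodularLattice _≈D_ _≤D_ _∨D_ _∧D_ ⊤D ⊥D _ᗮD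
  isOrthomodularLattice-D = record
    { isBoundedLattice = isBoundedLattice-D
    ; ᗮ-involutive     = λ u → relᗮ-involutive (proj₂ u)
    ; ᗮ-antitone       = relᗮ-antitone
    ; ᗮ-meet           = λ u → relᗮ-meet (proj₁ u)
    ; orthomodular     = λ {_} {v} u≤v → relᗮ-orthomodular u≤v (proj₂ v)
    }

  ↓a : OrthomodularLattice (c ⊔ ℓ₂) ℓ₁ ℓ₂
  ↓a = ↓ isOrthomodularLattice-D

  aMor-isMorphism : IsOMLatGalMorphism ↓a X (aMor isOrthomodularLattice-D)
  aMor-isMorphism = ᗮ-antitone , relᗮ-antitone , λ u y → relᗮ-galois y (proj₂ u)

  -- a† ∘ a = id: both components send u to a ∧ uᗮᗮᗮ, which is a ∧ uᗮ = uᗮₐ.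
  aMor-daggerMono : _≈Gal_ ↓a ↓a
    (compGal ↓a X ↓a (dagger ↓a X (aMor isOrthomodularLattice-D))
                     (aMor isOrthomodularLattice-D))
    (idGal ↓a)
  aMor-daggerMono = (λ u → relᗮ-ᗮᗮ (proj₁ u)) , (λ u → relᗮ-ᗮᗮ (proj₁ u))

lemma3p4 : {c ℓ₁ ℓ₂ : Level} (X : OrthomodularLattice c ℓ₁ ℓ₂)
    (a : OrthomodularLattice.Carrier X) →
    let open Downset X a in
    Σ (IsOrthomodularLattice _≈D_ _≤D_ _∨D_ _∧D_ ⊤D ⊥D _ᗮD) (λ isOML →
    IsOMLatGalMorphism (↓ isOML) X (aMor isOML)
    × _≈Gal_ (↓ isOML) (↓ isOML)
    (compGal (↓ isOML) X (↓ isOML) (dagger (↓ isOML) X (aMor isOML)) (aMor isOML))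
    (idGal (↓ isOML)))
lemma3p4 X a = isOrthomodularLattice-D , aMor-isMorphism , aMor-daggerMono
  where open DownsetProof X a
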